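{- If $G$ is a split graph (a finite simple graph whose vertex set can be partitioned into a clique $X$ and an independent set $V(G)\setminus X$), then $\operatorname{tlir}(G) \leq 2$.
   Context: A total coloring of $G$ assigns a color to every vertex and every edge of $G$. For a color $c$ and a vertex $v$, the total $c$-degree of $v$ is the number of edges of color $c$ incident to $v$, plus $1$ if $v$ itself has color $c$. A total coloring is a locally irregular total coloring (TLIR coloring) if for every edge $uv$, with $c$ the color of $uv$, the total $c$-degrees of $u$ and $v$ differ. $\operatorname{tlir}(G)$ is the minimum number of colors in a TLIR coloring of $G$. -}

module Defs where

open import Data.Nat using (ℕ; _+_)
open import Data.Fin using (Fin)
open import Data.Fin.Properties using (_≟_)
open import Data.Bool using (Bool; true; false; T; if_then_else_)
open import Data.List using (List; length; filter)
open import Data.List using () renaming (allFin to finList)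
open import Data.Product using (Σ; _×_)
open import Relation.Nullary using (¬_; Dec; does)
open import Relation.Binary.PropositionalEquality using (_≡_; _≢_)

record Graph (n : ℕ) : Set where
  field
    adj   : Fin n → Fin n → Bool
    sym   : ∀ u v → adj u v ≡ adj v u
    irrefl : ∀ v → adj v v ≡ false
open Graph public

IsSplit : ∀ {n} → Graph n → Set
IsSplit {n} G =
  Σ (Fin n → Bool) λ X →
    (∀ u v → X u ≡ true → X v ≡ true → u ≢ v → adj G u v ≡ true) ×
    (∀ u v → X u ≡ false → X v ≡ false → adj G u v ≡ false)

-- A total coloring with k colors: a color for every vertex and every edge.
-- Edges are unordered pairs {u,v}; the edge coloring is a function on ordered
-- pairs required to be symmetric on edges.
record TotalColoring {n} (G : Graph n) (k : ℕ) : Set where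
  field
    vcol : Fin n → Fin k
    ecol : Fin n → Fin n → Fin k
    ecol-sym : ∀ u v → adj G u v ≡ true → ecol u v ≡ ecol v u
open TotalColoring public

edgeDeg : ∀ {n k} {G : Graph n} → TotalColoring G k → Fin k → Fin n → ℕ
edgeDeg {n} {G = G} φ c v =
  length (filter (λ w → Data.Bool.T? (adj G v w Data.Bool.∧ does (ecol φ v w ≟ c)))
                 (finList n))

totalDeg : ∀ {n k} {G : Graph n} → TotalColoring G k → Fin k → Fin n → ℕ
totalDeg φ c v = edgeDeg φ c v + (if does (vcol φ v ≟ c) then 1 else 0)

IsTLIR : ∀ {n k} {G : Graph n} → TotalColoring G k → Set
IsTLIR {n} {G = G} φ =
  ∀ u v → adj G u v ≡ true → totalDeg φ (ecol φ u v) u ≢ totalDeg φ (ecol φ u v) v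

TlirAtMost : ∀ {n} → Graph n → ℕ → Set
TlirAtMost G k = Σ (TotalColoring G k) IsTLIR

-- Let k = |X| and L = ⌊k/2⌋.  Number the clique vertices 0, …, k-1 by a
-- position p and colour a clique edge uv, and a clique vertex u = v, with
-- colour 0 iff p u + p v ≥ k - 1.  Inside the clique, x then has total
-- 0-degree p x + 1 and total 1-degree k - 1 - p x, which separates every
-- clique edge in both colours.  The edges from x into the independent set get
-- colour 0 iff p x ≥ L, so the out-degree d x of x is added to one of these
-- two degrees; the separation survives if d is nondecreasing in p above L and
-- nonincreasing below L (sort by d, then reverse the lower half).  An
-- independent vertex, coloured 0 iff k is even, has total degree at most
-- (k - L) + [k even] ≤ L + 1 in colour 0 and L + [k odd] ≤ k - L in colour 1,
-- while a neighbour x with p x ≥ L, resp. p x < L, has degree at least L + 2,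
-- resp. k - L + 1, in the colour of their edge.

module Submission where

open import Data.Bool.Base using (Bool; true; false; not; _∧_; if_then_else_)
open import Data.Bool.Properties using (T?; ∧-zeroʳ; ∧-identityʳ)
open import Data.Empty using (⊥-elim)
open import Data.Fin.Base using (Fin; zero; suc; toℕ)
open import Data.Fin.Properties using (_≟_; toℕ<n; toℕ-injective)
open import Data.List.Base using (length; filter; tabulate)
open import Data.Nat.Base using (ℕ; zero; suc; _+_; _*_; _∸_; _≤_; _<_; z≤n; s≤s; z<s; s≤s⁻¹; ⌊_/2⌋)
open import Data.Nat.Properties hiding (_≟_)
open import Data.Product using (∃-syntax; _×_; _,_; proj₁; proj₂)
open import Data.Sum using (_⊎_; inj₁; inj₂)
open import Algebra.Properties.CommutativeSemigroup +-commutativeSemigroup using (xy∙z≈xz∙y)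
open import Function.Base using (_∘_; id)
open import Function.Bundles using (mk⇔)
open import Relation.Binary.Definitions using (tri<; tri≈; tri>)
open import Relation.Binary.PropositionalEquality
open import Relation.Nullary using (¬_)
open import Relation.Nullary.Decidable using (Dec; yes; no; does; dec-true; dec-false; does-⇔)

open import Defs hiding (sym)

private variable
  A B : Set
  n : ℕ
  P Q : Fin n → Bool

true⇒ : (a? : Dec A) → does a? ≡ true → A
true⇒ (yes a) _ = a

not-true⇒ : (a? : Dec A) → not (does a?) ≡ true → ¬ A
not-true⇒ (no ¬a) _ = ¬a

∧-true⇒ : ∀ a {b} → a ∧ b ≡ true → a ≡ true × b ≡ true
∧-true⇒ true e = refl , e

∧-monoʳ-true : ∀ {a b c} → (b ≡ true → c ≡ true) → a ∧ b ≡ true → a ∧ c ≡ true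
∧-monoʳ-true {true} b⇒c = b⇒c

does-mono : (a? : Dec A) (b? : Dec B) → (A → B) → does a? ≡ true → does b? ≡ true
does-mono (yes a) b? a⇒b _ = dec-true b? (a⇒b a)

count : (Fin n → Bool) → ℕ
count {zero}  P = 0
count {suc n} P = if P zero then suc (count (P ∘ suc)) else count (P ∘ suc)

length-filter-tabulate : (f : Fin n → A) (P : A → Bool) →
  length (filter (T? ∘ P) (tabulate f)) ≡ count (P ∘ f)
length-filter-tabulate {zero}  f P = refl
length-filter-tabulate {suc n} f P with P (f zero)
... | true  = cong suc (length-filter-tabulate (f ∘ suc) P)
... | false = length-filter-tabulate (f ∘ suc) P

count-cong : (∀ i → P i ≡ Q i) → count P ≡ count Q
count-cong {zero}  eq = refl
count-cong {suc n} {P} {Q} eq rewrite eq zero with Q zero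
... | true  = cong suc (count-cong (eq ∘ suc))
... | false = count-cong (eq ∘ suc)

count≤n : (P : Fin n → Bool) → count P ≤ n
count≤n {zero}  P = z≤n
count≤n {suc n} P with P zero
... | true  = s≤s (count≤n (P ∘ suc))
... | false = m≤n⇒m≤1+n (count≤n (P ∘ suc))

count-none : (∀ i → P i ≡ false) → count P ≡ 0
count-none {zero}  none = refl
count-none {suc n} none rewrite none zero = count-none (none ∘ suc)

count-mono : (∀ i → P i ≡ true → Q i ≡ true) → count P ≤ count Q
count-mono {zero} P⇒Q = z≤n
count-mono {suc n} {P} {Q} P⇒Q with P zero in p | Q zero in q
... | true  | true  = s≤s (count-mono (P⇒Q ∘ suc))
... | false | true  = m≤n⇒m≤1+n (count-mono (P⇒Q ∘ suc))
... | false | false = count-mono (P⇒Q ∘ suc)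
... | true  | false with () ← trans (sym q) (P⇒Q zero p)

count-mono-< : (∀ i → P i ≡ true → Q i ≡ true) →
  ∀ j → P j ≡ false → Q j ≡ true → count P < count Q
count-mono-< {suc n} {P} {Q} P⇒Q zero pj qj rewrite pj | qj = s≤s (count-mono (P⇒Q ∘ suc))
count-mono-< {suc n} {P} {Q} P⇒Q (suc j) pj qj with P zero in p | Q zero in q
... | true  | true  = s≤s (count-mono-< (P⇒Q ∘ suc) j pj qj)
... | false | true  = m≤n⇒m≤1+n (count-mono-< (P⇒Q ∘ suc) j pj qj)
... | false | false = count-mono-< (P⇒Q ∘ suc) j pj qj
... | true  | false with () ← trans (sym q) (P⇒Q zero p)

count-split : (P Q : Fin n → Bool) →
  count P ≡ count (λ i → P i ∧ Q i) + count (λ i → P i ∧ not (Q i))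
count-split {zero}  P Q = refl
count-split {suc n} P Q with P zero | Q zero
... | true  | true  = cong suc (count-split (P ∘ suc) (Q ∘ suc))
... | true  | false = trans (cong suc (count-split (P ∘ suc) (Q ∘ suc))) (sym (+-suc _ _))
... | false | true  = count-split (P ∘ suc) (Q ∘ suc)
... | false | false = count-split (P ∘ suc) (Q ∘ suc)

count-witness : 0 < count P → ∃[ i ] P i ≡ true
count-witness {suc n} {P} pos with P zero in p
... | true  = zero , p
... | false with i , pi ← count-witness {P = P ∘ suc} pos = suc i , pi

count-pos : ∀ i → P i ≡ true → 0 < count P
count-pos {suc n} {P} zero    pi rewrite pi = z<s
count-pos {suc n} {P} (suc i) pi with P zero
... | true  = z<s
... | false = count-pos i pi

count-at : (P : Fin n → Bool) (x : Fin n) →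
  count (λ i → P i ∧ does (i ≟ x)) ≡ (if P x then 1 else 0)
count-at {suc n} P zero with P zero
... | true  = cong suc (count-none λ i → ∧-zeroʳ (P (suc i)))
... | false = count-none λ i → ∧-zeroʳ (P (suc i))
count-at {suc n} P (suc x) rewrite ∧-zeroʳ (P zero) = count-at (P ∘ suc) x

count-remove : (P : Fin n → Bool) (x : Fin n) →
  count P ≡ count (λ i → P i ∧ not (does (i ≟ x))) + (if P x then 1 else 0)
count-remove P x = begin
  count P                                                           ≡⟨ count-split P (λ i → does (i ≟ x)) ⟩
  count (λ i → P i ∧ does (i ≟ x)) + count (λ i → P i ∧ not (does (i ≟ x)))
                                                                    ≡⟨ +-comm (count (λ i → P i ∧ does (i ≟ x))) _ ⟩
  count (λ i → P i ∧ not (does (i ≟ x))) + count (λ i → P i ∧ does (i ≟ x))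
                                                                    ≡⟨ cong (count (λ i → P i ∧ not (does (i ≟ x))) +_) (count-at P x) ⟩
  count (λ i → P i ∧ not (does (i ≟ x))) + (if P x then 1 else 0) ∎
  where open ≡-Reasoning

count-∧-const : (P : Fin n → Bool) (b : Bool) → count (λ i → P i ∧ b) ≡ (if b then count P else 0)
count-∧-const P true  = count-cong (∧-identityʳ ∘ P)
count-∧-const P false = count-none (∧-zeroʳ ∘ P)

count-singleton : ∀ x → (∀ i → P i ≡ true → i ≡ x) → P x ≡ true → count P ≡ 1
count-singleton {P = P} x only px = begin
  count P                                                            ≡⟨ count-split P (λ i → does (i ≟ x)) ⟩
  count (λ i → P i ∧ does (i ≟ x)) + count (λ i → P i ∧ not (does (i ≟ x)))
    ≡⟨ cong₂ _+_ (count-at P x) (count-none outside) ⟩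
  (if P x then 1 else 0) + 0                                         ≡⟨ cong (λ b → (if b then 1 else 0) + 0) px ⟩
  1                                                                  ∎
  where
  open ≡-Reasoning
  outside : ∀ i → P i ∧ not (does (i ≟ x)) ≡ false
  outside i with P i in pi | i ≟ x
  ... | false | _     = refl
  ... | true  | yes _ = refl
  ... | true  | no i≢x = ⊥-elim (i≢x (only i pi))

count-atMostOne : (∀ i j → P i ≡ true → P j ≡ true → i ≡ j) → count P ≤ 1
count-atMostOne {P = P} unique with count P in c
... | zero  = z≤n
... | suc _ with x , px ← count-witness {P = P} (subst (0 <_) (sym c) z<s) =
  ≤-reflexive (trans (sym c) (count-singleton x (λ i pi → unique i x pi px) px))

unit-steps-hit : (g : ℕ → ℕ) → g 0 ≡ 0 → (∀ m → g (suc m) ≤ suc (g m)) →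
  ∀ m t → t < g m → ∃[ j ] g j ≡ t × t < g (suc j)
unit-steps-hit g g0 step zero t t<g0 = ⊥-elim (n≮0 (subst (t <_) g0 t<g0))
unit-steps-hit g g0 step (suc m) t t<g with t <? g m
... | yes t<gm = unit-steps-hit g g0 step m t t<gm
... | no  t≮gm = m , ≤-antisym (≮⇒≥ t≮gm) (s≤s⁻¹ (≤-trans t<g (step m))) , t<g

module Ranking {n} (S : Fin n → Bool) (key : Fin n → ℕ)
  (key-injective : ∀ u v → key u ≡ key v → u ≡ v)
  (bound : ℕ) (key<bound : ∀ x → key x < bound) where

  below : ℕ → ℕ
  below m = count (λ z → S z ∧ does (key z <? m))

  rank : Fin n → ℕ
  rank x = below (key x)

  below-mono : ∀ {m m′} → m ≤ m′ → below m ≤ below m′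
  below-mono {m} {m′} m≤m′ = count-mono λ z →
    ∧-monoʳ-true (does-mono (key z <? m) (key z <? m′) λ lt → <-≤-trans lt m≤m′)

  not-below-self : ∀ x → S x ∧ does (key x <? key x) ≡ false
  not-below-self x = trans (cong (S x ∧_) (dec-false (key x <? key x) (<-irrefl refl))) (∧-zeroʳ (S x))

  rank-mono-< : ∀ {u v} → S u ≡ true → key u < key v → rank u < rank v
  rank-mono-< {u} {v} su u<v = count-mono-<
    (λ z → ∧-monoʳ-true (does-mono (key z <? key u) (key z <? key v) λ lt → <-trans lt u<v))
    u (not-below-self u) (cong₂ _∧_ su (dec-true (key u <? key v) u<v))

  rank<count : ∀ {x} → S x ≡ true → rank x < count S
  rank<count {x} sx = count-mono-< (λ z e → proj₁ (∧-true⇒ (S z) e))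
    x (not-below-self x) sx

  rank-<⇒key-< : ∀ {u v} → rank u < rank v → key u < key v
  rank-<⇒key-< ru<rv = ≰⇒> λ kv≤ku → <⇒≱ ru<rv (below-mono kv≤ku)

  rank-injective : ∀ {u v} → S u ≡ true → S v ≡ true → rank u ≡ rank v → u ≡ v
  rank-injective {u} {v} su sv ru≡rv with <-cmp (key u) (key v)
  ... | tri< ku<kv _ _ = ⊥-elim (<-irrefl ru≡rv (rank-mono-< su ku<kv))
  ... | tri≈ _ ku≡kv _ = key-injective u v ku≡kv
  ... | tri> _ _ kv<ku = ⊥-elim (<-irrefl (sym ru≡rv) (rank-mono-< sv kv<ku))

  below-zero : below 0 ≡ 0
  below-zero = count-none λ z → ∧-zeroʳ (S z)

  below-bound : below bound ≡ count S
  below-bound = count-cong λ z → trans (cong (S z ∧_) (dec-true (key z <? bound) (key<bound z))) (∧-identityʳ (S z))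

  atKey : ℕ → Fin n → Bool
  atKey m z = (S z ∧ does (key z <? suc m)) ∧ not (does (key z <? m))

  atKey⇒ : ∀ {m z} → atKey m z ≡ true → S z ≡ true × key z ≡ m
  atKey⇒ {m} {z} e with ∧-true⇒ (S z ∧ does (key z <? suc m)) e
  ... | e₁ , ≮m with ∧-true⇒ (S z) e₁
  ... | s , <1+m = s , ≤-antisym (s≤s⁻¹ (true⇒ (key z <? suc m) <1+m)) (≮⇒≥ (not-true⇒ (key z <? m) ≮m))

  below-suc : ∀ m → below (suc m) ≤ below m + count (atKey m)
  below-suc m = begin
    below (suc m)                                                      ≡⟨ count-split _ (λ z → does (key z <? m)) ⟩
    count (λ z → (S z ∧ does (key z <? suc m)) ∧ does (key z <? m)) + count (atKey m)
      ≤⟨ +-monoˡ-≤ (count (atKey m)) (count-mono earlier) ⟩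
    below m + count (atKey m)                                          ∎
    where
    open ≤-Reasoning
    earlier : ∀ z → (S z ∧ does (key z <? suc m)) ∧ does (key z <? m) ≡ true → S z ∧ does (key z <? m) ≡ true
    earlier z e with ∧-true⇒ (S z ∧ does (key z <? suc m)) e
    ... | e₁ , <m = cong₂ _∧_ (proj₁ (∧-true⇒ (S z) e₁)) <m

  below-step : ∀ m → below (suc m) ≤ suc (below m)
  below-step m = begin
    below (suc m)               ≤⟨ below-suc m ⟩
    below m + count (atKey m)   ≤⟨ +-monoʳ-≤ (below m) (count-atMostOne λ i j ei ej →
                                     key-injective i j (trans (proj₂ (atKey⇒ ei)) (sym (proj₂ (atKey⇒ ej))))) ⟩
    below m + 1                 ≡⟨ +-comm (below m) 1 ⟩
    suc (below m)               ∎
    where open ≤-Reasoning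

  rank-surjective : ∀ t → t < count S → ∃[ x ] S x ≡ true × rank x ≡ t
  rank-surjective t t<|S| with unit-steps-hit below below-zero below-step bound t (subst (t <_) (sym below-bound) t<|S|)
  ... | j , below-j≡t , t<below-1+j with count-witness {P = atKey j} (+-cancelˡ-< t 0 _ t+0<t+c)
    where
    t+0<t+c : t + 0 < t + count (atKey j)
    t+0<t+c = begin-strict
      t + 0                     ≡⟨ +-identityʳ t ⟩
      t                         <⟨ t<below-1+j ⟩
      below (suc j)             ≤⟨ below-suc j ⟩
      below j + count (atKey j) ≡⟨ cong (_+ count (atKey j)) below-j≡t ⟩
      t + count (atKey j)       ∎
      where open ≤-Reasoning
  ... | x , hit with atKey⇒ hit
  ... | sx , kx≡j = x , sx , trans (cong below kx≡j) below-j≡t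

flipBelow : ℕ → ℕ → ℕ
flipBelow L t = if does (t <? L) then L ∸ suc t else t

flipBelow-low : ∀ {L t} → t < L → flipBelow L t ≡ L ∸ suc t
flipBelow-low {L} {t} t<L rewrite dec-true (t <? L) t<L = refl

flipBelow-high : ∀ {L t} → L ≤ t → flipBelow L t ≡ t
flipBelow-high {L} {t} L≤t rewrite dec-false (t <? L) (≤⇒≯ L≤t) = refl

flipBelow-<L : ∀ {L t} → t < L → flipBelow L t < L
flipBelow-<L t<L rewrite flipBelow-low t<L = ∸-monoʳ-< z<s t<L

flipBelow-≥L⁻¹ : ∀ {L t} → L ≤ flipBelow L t → L ≤ t
flipBelow-≥L⁻¹ L≤ft = ≮⇒≥ λ t<L → <⇒≱ (flipBelow-<L t<L) L≤ft

flipBelow-<L⁻¹ : ∀ {L t} → flipBelow L t < L → t < L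
flipBelow-<L⁻¹ ft<L = ≰⇒> λ L≤t → <⇒≱ ft<L (≤-trans L≤t (≤-reflexive (sym (flipBelow-high L≤t))))

flipBelow-involutive : ∀ L t → flipBelow L (flipBelow L t) ≡ t
flipBelow-involutive L t with t <? L
... | no  t≮L = trans (cong (flipBelow L) (flipBelow-high (≮⇒≥ t≮L))) (flipBelow-high (≮⇒≥ t≮L))
... | yes t<L = begin
  flipBelow L (flipBelow L t) ≡⟨ cong (flipBelow L) (flipBelow-low t<L) ⟩
  flipBelow L (L ∸ suc t)   ≡⟨ flipBelow-low (∸-monoʳ-< z<s t<L) ⟩
  L ∸ suc (L ∸ suc t)       ≡⟨ cong (L ∸_) (sym (+-∸-assoc 1 t<L)) ⟩
  L ∸ (L ∸ t)               ≡⟨ m∸[m∸n]≡n (<⇒≤ t<L) ⟩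
  t                         ∎
  where open ≡-Reasoning

flipBelow-<k : ∀ {L t k} → L ≤ k → t < k → flipBelow L t < k
flipBelow-<k {L} {t} {k} L≤k t<k with t <? L
... | yes t<L = <-≤-trans (flipBelow-<L t<L) L≤k
... | no  t≮L = subst (_< k) (sym (flipBelow-high (≮⇒≥ t≮L))) t<k

flipBelow-mono-high : ∀ {L t u} → L ≤ flipBelow L t → flipBelow L t < flipBelow L u → t < u
flipBelow-mono-high {L} {t} {u} L≤ft ft<fu =
  subst₂ _<_ (flipBelow-high L≤t) (flipBelow-high L≤u) ft<fu
  where
  L≤t : L ≤ t
  L≤t = flipBelow-≥L⁻¹ L≤ft
  L≤u : L ≤ u
  L≤u = flipBelow-≥L⁻¹ (≤-trans L≤ft (<⇒≤ ft<fu))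

flipBelow-anti-low : ∀ {L t u} → flipBelow L u < L → flipBelow L t < flipBelow L u → u < t
flipBelow-anti-low {L} {t} {u} fu<L ft<fu =
  s≤s⁻¹ (∸-cancelʳ-< {o = L} (subst₂ _<_ (flipBelow-low t<L) (flipBelow-low u<L) ft<fu))
  where
  u<L : u < L
  u<L = flipBelow-<L⁻¹ fu<L
  t<L : t < L
  t<L = flipBelow-<L⁻¹ (<-trans ft<fu fu<L)

module Enumeration {n} (S : Fin n → Bool) (r : Fin n → ℕ)
  (r-injective : ∀ {u v} → S u ≡ true → S v ≡ true → r u ≡ r v → u ≡ v)
  (r-surjective : ∀ t → t < count S → ∃[ x ] S x ≡ true × r x ≡ t) where

  count-below : ∀ m → m ≤ count S → count (λ w → S w ∧ not (does (m ≤? r w))) ≡ m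
  count-below zero    _      = count-none λ w → ∧-zeroʳ (S w)
  count-below (suc m) m<|S| with r-surjective m m<|S|
  ... | x , sx , rx≡m = begin
    count (λ w → S w ∧ not (does (suc m ≤? r w)))
      ≡⟨ count-split _ (λ w → does (m ≤? r w)) ⟩
    count (λ w → (S w ∧ not (does (suc m ≤? r w))) ∧ does (m ≤? r w))
      + count (λ w → (S w ∧ not (does (suc m ≤? r w))) ∧ not (does (m ≤? r w)))
      ≡⟨ cong₂ _+_ (count-singleton x only-x hit-x) (count-cong below-m) ⟩
    suc (count (λ w → S w ∧ not (does (m ≤? r w))))
      ≡⟨ cong suc (count-below m (<⇒≤ m<|S|)) ⟩
    suc m
      ∎
    where
    open ≡-Reasoning
    only-x : ∀ w → (S w ∧ not (does (suc m ≤? r w))) ∧ does (m ≤? r w) ≡ true → w ≡ x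
    only-x w e with ∧-true⇒ (S w ∧ not (does (suc m ≤? r w))) e
    ... | e₁ , m≤rw with ∧-true⇒ (S w) e₁
    ... | sw , rw≯m = r-injective sw sx
      (trans (≤-antisym (≮⇒≥ (not-true⇒ (suc m ≤? r w) rw≯m)) (true⇒ (m ≤? r w) m≤rw)) (sym rx≡m))
    hit-x : (S x ∧ not (does (suc m ≤? r x))) ∧ does (m ≤? r x) ≡ true
    hit-x rewrite sx | rx≡m | dec-false (suc m ≤? m) (<-irrefl refl) | dec-true (m ≤? m) ≤-refl = refl
    below-m : ∀ w → (S w ∧ not (does (suc m ≤? r w))) ∧ not (does (m ≤? r w))
                  ≡ S w ∧ not (does (m ≤? r w))
    below-m w with m ≤? r w
    ... | yes m≤r rewrite dec-true (m ≤? r w) m≤r = trans (∧-zeroʳ _) (sym (∧-zeroʳ (S w)))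
    ... | no  m≰r rewrite dec-false (m ≤? r w) m≰r | dec-false (suc m ≤? r w) (m≰r ∘ <⇒≤) = ∧-identityʳ _

  count-atLeast : ∀ m → m ≤ count S → count (λ w → S w ∧ does (m ≤? r w)) ≡ count S ∸ m
  count-atLeast m m≤|S| = begin
    count (λ w → S w ∧ does (m ≤? r w))
      ≡⟨ sym (m+n∸n≡m _ m) ⟩
    count (λ w → S w ∧ does (m ≤? r w)) + m ∸ m
      ≡⟨ cong (λ c → count (λ w → S w ∧ does (m ≤? r w)) + c ∸ m) (sym (count-below m m≤|S|)) ⟩
    count (λ w → S w ∧ does (m ≤? r w)) + count (λ w → S w ∧ not (does (m ≤? r w))) ∸ m
      ≡⟨ cong (_∸ m) (sym (count-split S (λ w → does (m ≤? r w)))) ⟩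
    count S ∸ m
      ∎
    where open ≡-Reasoning

lex-< : ∀ {a b i j m} → a < b → i < m → a * m + i < b * m + j
lex-< {a} {b} {i} {j} {m} a<b i<m = begin-strict
  a * m + i     <⟨ +-monoʳ-< (a * m) i<m ⟩
  a * m + m     ≡⟨ +-comm (a * m) m ⟩
  suc a * m     ≤⟨ *-monoˡ-≤ m a<b ⟩
  b * m         ≤⟨ m≤m+n (b * m) j ⟩
  b * m + j     ∎
  where open ≤-Reasoning

⌊n/2⌋-parity : ∀ k → k ≡ ⌊ k /2⌋ + ⌊ k /2⌋ ⊎ k ≡ suc (⌊ k /2⌋ + ⌊ k /2⌋)
⌊n/2⌋-parity zero          = inj₁ refl
⌊n/2⌋-parity (suc zero)    = inj₂ refl
⌊n/2⌋-parity (suc (suc k)) with ⌊n/2⌋-parity k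
... | inj₁ e = inj₁ (cong suc (trans (cong suc e) (sym (+-suc _ _))))
... | inj₂ e = inj₂ (cong suc (trans (cong suc e) (cong suc (sym (+-suc _ _)))))

parity-bounds : ∀ {k L} → k ≡ L + L ⊎ k ≡ suc (L + L) →
  k ∸ L + (if does (k ≤? L + L) then 1 else 0) ≤ suc L ×
  L + (if not (does (k ≤? L + L)) then 1 else 0) ≤ k ∸ L
parity-bounds {L = L} (inj₁ refl) rewrite m+n∸n≡m L L | dec-true (L + L ≤? L + L) ≤-refl =
  ≤-reflexive (+-comm L 1) , ≤-reflexive (+-identityʳ L)
parity-bounds {L = L} (inj₂ refl) rewrite m+n∸n≡m (suc L) L | dec-false (suc (L + L) ≤? L + L) (<-irrefl refl) =
  ≤-reflexive (+-identityʳ (suc L)) , ≤-reflexive (+-comm L 1)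

paint : Bool → Fin 2
paint true  = zero
paint false = suc zero

selects : Fin 2 → Bool → Bool
selects zero       b = b
selects (suc zero) b = not b

paint-≟ : ∀ b c → does (paint b ≟ c) ≡ selects c b
paint-≟ true  zero       = refl
paint-≟ true  (suc zero) = refl
paint-≟ false zero       = refl
paint-≟ false (suc zero) = refl

adjacent-distinct : (G : Graph n) → ∀ {u v} → adj G u v ≡ true → u ≢ v
adjacent-distinct G {u} uv refl with () ← trans (sym uv) (irrefl G u)

totalDeg-count : ∀ {k} {G : Graph n} (φ : TotalColoring G k) c v →
  totalDeg φ c v ≡ count (λ w → adj G v w ∧ does (ecol φ v w ≟ c)) + (if does (vcol φ v ≟ c) then 1 else 0)
totalDeg-count {G = G} φ c v =
  cong (_+ (if does (vcol φ v ≟ c) then 1 else 0)) (length-filter-tabulate id (λ w → adj G v w ∧ does (ecol φ v w ≟ c)))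

module SplitGraphColouring (G : Graph n) (X : Fin n → Bool)
  (clique : ∀ u v → X u ≡ true → X v ≡ true → u ≢ v → adj G u v ≡ true)
  (independent : ∀ u v → X u ≡ false → X v ≡ false → adj G u v ≡ false) where

  k : ℕ
  k = count X

  outDegree : Fin n → ℕ
  outDegree x = count (λ w → adj G x w ∧ not (X w))

  key : Fin n → ℕ
  key x = outDegree x * n + toℕ x

  key-injective : ∀ u v → key u ≡ key v → u ≡ v
  key-injective u v ku≡kv with <-cmp (outDegree u) (outDegree v)
  ... | tri< du<dv _ _ = ⊥-elim (<-irrefl ku≡kv (lex-< du<dv (toℕ<n u)))
  ... | tri> _ _ dv<du = ⊥-elim (<-irrefl (sym ku≡kv) (lex-< dv<du (toℕ<n v)))
  ... | tri≈ _ du≡dv _ = toℕ-injective (+-cancelˡ-≡ (outDegree u * n) _ _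
                           (trans ku≡kv (cong (λ d → d * n + toℕ v) (sym du≡dv))))

  key<bound : ∀ x → key x < suc n * n
  key<bound x = subst (key x <_) (+-identityʳ (suc n * n)) (lex-< (s≤s (count≤n (λ w → adj G x w ∧ not (X w)))) (toℕ<n x))

  key-<⇒outDegree-≤ : ∀ {u v} → key u < key v → outDegree u ≤ outDegree v
  key-<⇒outDegree-≤ {u} {v} ku<kv = ≮⇒≥ λ dv<du → <-asym ku<kv (lex-< dv<du (toℕ<n v))

  open Ranking X key key-injective (suc n * n) key<bound

  L : ℕ
  L = ⌊ k /2⌋

  position : Fin n → ℕ
  position x = flipBelow L (rank x)

  position-injective : ∀ {u v} → X u ≡ true → X v ≡ true → position u ≡ position v → u ≡ v
  position-injective {u} {v} xu xv pu≡pv = rank-injective xu xv (begin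
    rank u                                ≡⟨ sym (flipBelow-involutive L (rank u)) ⟩
    flipBelow L (position u)              ≡⟨ cong (flipBelow L) pu≡pv ⟩
    flipBelow L (position v)              ≡⟨ flipBelow-involutive L (rank v) ⟩
    rank v                                ∎)
    where open ≡-Reasoning

  position-surjective : ∀ t → t < k → ∃[ x ] X x ≡ true × position x ≡ t
  position-surjective t t<k =
    let x , xx , rx≡ft = rank-surjective (flipBelow L t) (flipBelow-<k (⌊n/2⌋≤n k) t<k)
    in x , xx , trans (cong (flipBelow L) rx≡ft) (flipBelow-involutive L t)

  position<k : ∀ {x} → X x ≡ true → position x < k
  position<k xx = flipBelow-<k (⌊n/2⌋≤n k) (rank<count xx)

  open Enumeration X position position-injective position-surjective

  outDegree-mono-high : ∀ {u v} → L ≤ position u → position u < position v → outDegree u ≤ outDegree v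
  outDegree-mono-high L≤pu pu<pv = key-<⇒outDegree-≤ (rank-<⇒key-< (flipBelow-mono-high L≤pu pu<pv))

  outDegree-anti-low : ∀ {u v} → position v < L → position u < position v → outDegree v ≤ outDegree u
  outDegree-anti-low pv<L pu<pv = key-<⇒outDegree-≤ (rank-<⇒key-< (flipBelow-anti-low pv<L pu<pv))

  high : Fin n → Bool
  high x = does (L ≤? position x)

  upper : Fin n → Fin n → Bool
  upper u v = does (k ≤? suc (position u + position v))

  upper-sym : ∀ u v → upper u v ≡ upper v u
  upper-sym u v = cong (λ s → does (k ≤? suc s)) (+-comm (position u) (position v))

  upper-threshold : ∀ x w → upper x w ≡ does (k ∸ suc (position x) ≤? position w)
  upper-threshold x w = does-⇔ (mk⇔ (m≤n+o⇒m∸n≤o k (suc (position x)))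
    (λ le → ≤-trans (m≤n+m∸n k (suc (position x))) (+-monoʳ-≤ (suc (position x)) le)))
    (k ≤? suc (position x + position w)) (k ∸ suc (position x) ≤? position w)

  k-even : Bool
  k-even = does (k ≤? L + L)

  -- true stands for colour 0 (see paint), and shade v v is the colour of the vertex v.
  shade : Fin n → Fin n → Bool
  shade u v = if X u then (if X v then upper u v else high u) else (if X v then high v else k-even)

  shade-sym : ∀ u v → shade u v ≡ shade v u
  shade-sym u v with X u | X v
  ... | true  | true  = upper-sym u v
  ... | true  | false = refl
  ... | false | true  = refl
  ... | false | false = refl

  colouring : TotalColoring G 2
  colouring = record
    { vcol     = λ v → paint (shade v v)
    ; ecol     = λ u v → paint (shade u v)
    ; ecol-sym = λ u v _ → cong paint (shade-sym u v)
    }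

  shadeDegree : (Bool → Bool) → Fin n → ℕ
  shadeDegree f v = count (λ w → adj G v w ∧ f (shade v w)) + (if f (shade v v) then 1 else 0)

  totalDeg-shadeDegree : ∀ c v → totalDeg colouring c v ≡ shadeDegree (selects c) v
  totalDeg-shadeDegree c v = trans (totalDeg-count colouring c v)
    (cong₂ _+_ (count-cong λ w → cong (adj G v w ∧_) (paint-≟ (shade v w) c))
               (cong (λ b → if b then 1 else 0) (paint-≟ (shade v v) c)))

  clique-shadeDegree : ∀ f {x} → X x ≡ true →
    shadeDegree f x ≡ count (λ w → X w ∧ f (upper x w)) + (if f (high x) then outDegree x else 0)
  clique-shadeDegree f {x} xx = begin
    count E + (if f (shade x x) then 1 else 0)
      ≡⟨ cong (λ b → count E + (if b then 1 else 0)) shade-xx ⟩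
    count E + self
      ≡⟨ cong (_+ self) (count-split E X) ⟩
    count (λ w → E w ∧ X w) + count (λ w → E w ∧ not (X w)) + self
      ≡⟨ xy∙z≈xz∙y (count (λ w → E w ∧ X w)) (count (λ w → E w ∧ not (X w))) self ⟩
    count (λ w → E w ∧ X w) + self + count (λ w → E w ∧ not (X w))
      ≡⟨ cong₂ _+_ (cong (_+ self) (count-cong inside)) (count-cong outside) ⟩
    count (λ w → C w ∧ not (does (w ≟ x))) + self + count (λ w → (adj G x w ∧ not (X w)) ∧ f (high x))
      ≡⟨ cong₂ _+_ (sym (count-remove C x)) (count-∧-const (λ w → adj G x w ∧ not (X w)) (f (high x))) ⟩
    count C + (if f (high x) then outDegree x else 0)
      ∎
    where
    open ≡-Reasoning
    E C : Fin n → Bool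
    E w = adj G x w ∧ f (shade x w)
    C w = X w ∧ f (upper x w)
    self : ℕ
    self = if C x then 1 else 0
    shade-xx : f (shade x x) ≡ C x
    shade-xx rewrite xx = refl
    inside : ∀ w → E w ∧ X w ≡ C w ∧ not (does (w ≟ x))
    inside w with w ≟ x
    ... | yes refl rewrite irrefl G w = sym (∧-zeroʳ (C w))
    ... | no  w≢x rewrite xx with X w in xw
    ...   | false = ∧-zeroʳ (adj G x w ∧ f (high x))
    ...   | true  rewrite clique x w xx xw (w≢x ∘ sym) = refl
    outside : ∀ w → E w ∧ not (X w) ≡ (adj G x w ∧ not (X w)) ∧ f (high x)
    outside w rewrite xx with X w | adj G x w
    ... | true  | true  = ∧-zeroʳ (f (upper x w))
    ... | true  | false = refl
    ... | false | true  = ∧-identityʳ (f (high x))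
    ... | false | false = refl

  independent-shadeDegree : ∀ f {y} → X y ≡ false →
    shadeDegree f y ≤ count (λ w → X w ∧ f (high w)) + (if f k-even then 1 else 0)
  independent-shadeDegree f {y} xy =
    +-mono-≤ (count-mono neighbour) (≤-reflexive (cong (λ s → if f s then 1 else 0) shade-yy))
    where
    shade-yy : shade y y ≡ k-even
    shade-yy rewrite xy = refl
    shade-yw : ∀ {w} → X w ≡ true → shade y w ≡ high w
    shade-yw xw rewrite xy | xw = refl
    neighbour : ∀ w → adj G y w ∧ f (shade y w) ≡ true → X w ∧ f (high w) ≡ true
    neighbour w e with ∧-true⇒ (adj G y w) e | X w in xw
    ... | yw , _  | false with () ← trans (sym yw) (independent y w xy xw)
    ... | _  , fs | true  = subst (λ s → f s ≡ true) (shade-yw xw) fs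

  deg-zero-clique : ∀ {x} → X x ≡ true →
    totalDeg colouring zero x ≡ suc (position x) + (if high x then outDegree x else 0)
  deg-zero-clique {x} xx = begin
    totalDeg colouring zero x                                          ≡⟨ totalDeg-shadeDegree zero x ⟩
    shadeDegree id x                                                   ≡⟨ clique-shadeDegree id xx ⟩
    count (λ w → X w ∧ upper x w) + (if high x then outDegree x else 0) ≡⟨ cong (_+ (if high x then outDegree x else 0)) count-upper ⟩
    suc (position x) + (if high x then outDegree x else 0)             ∎
    where
    open ≡-Reasoning
    count-upper : count (λ w → X w ∧ upper x w) ≡ suc (position x)
    count-upper = begin
      count (λ w → X w ∧ upper x w)                                  ≡⟨ count-cong (λ w → cong (X w ∧_) (upper-threshold x w)) ⟩
      count (λ w → X w ∧ does (k ∸ suc (position x) ≤? position w))  ≡⟨ count-atLeast (k ∸ suc (position x)) (m∸n≤m k (suc (position x))) ⟩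
      k ∸ (k ∸ suc (position x))                                     ≡⟨ m∸[m∸n]≡n (position<k xx) ⟩
      suc (position x)                                               ∎

  deg-one-clique : ∀ {x} → X x ≡ true →
    totalDeg colouring (suc zero) x ≡ k ∸ suc (position x) + (if not (high x) then outDegree x else 0)
  deg-one-clique {x} xx = begin
    totalDeg colouring (suc zero) x                                    ≡⟨ totalDeg-shadeDegree (suc zero) x ⟩
    shadeDegree not x                                                  ≡⟨ clique-shadeDegree not xx ⟩
    count (λ w → X w ∧ not (upper x w)) + (if not (high x) then outDegree x else 0)
      ≡⟨ cong (_+ (if not (high x) then outDegree x else 0)) count-lower ⟩
    k ∸ suc (position x) + (if not (high x) then outDegree x else 0)   ∎
    where
    open ≡-Reasoning
    count-lower : count (λ w → X w ∧ not (upper x w)) ≡ k ∸ suc (position x)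
    count-lower = begin
      count (λ w → X w ∧ not (upper x w))                                  ≡⟨ count-cong (λ w → cong (λ b → X w ∧ not b) (upper-threshold x w)) ⟩
      count (λ w → X w ∧ not (does (k ∸ suc (position x) ≤? position w)))  ≡⟨ count-below (k ∸ suc (position x)) (m∸n≤m k (suc (position x))) ⟩
      k ∸ suc (position x)                                                 ∎

  deg-zero-independent : ∀ {y} → X y ≡ false → totalDeg colouring zero y ≤ k ∸ L + (if k-even then 1 else 0)
  deg-zero-independent {y} xy = begin
    totalDeg colouring zero y                                  ≡⟨ totalDeg-shadeDegree zero y ⟩
    shadeDegree id y                                           ≤⟨ independent-shadeDegree id xy ⟩
    count (λ w → X w ∧ high w) + (if k-even then 1 else 0)     ≡⟨ cong (_+ (if k-even then 1 else 0)) (count-atLeast L (⌊n/2⌋≤n k)) ⟩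
    k ∸ L + (if k-even then 1 else 0)                          ∎
    where open ≤-Reasoning

  deg-one-independent : ∀ {y} → X y ≡ false → totalDeg colouring (suc zero) y ≤ L + (if not k-even then 1 else 0)
  deg-one-independent {y} xy = begin
    totalDeg colouring (suc zero) y                                    ≡⟨ totalDeg-shadeDegree (suc zero) y ⟩
    shadeDegree not y                                                  ≤⟨ independent-shadeDegree not xy ⟩
    count (λ w → X w ∧ not (high w)) + (if not k-even then 1 else 0)   ≡⟨ cong (_+ (if not k-even then 1 else 0)) (count-below L (⌊n/2⌋≤n k)) ⟩
    L + (if not k-even then 1 else 0)                                  ∎
    where open ≤-Reasoning

  clique-edge : ∀ {u v} → X u ≡ true → X v ≡ true → position u < position v →
    totalDeg colouring zero u < totalDeg colouring zero v ×
    totalDeg colouring (suc zero) v < totalDeg colouring (suc zero) u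
  clique-edge {u} {v} xu xv pu<pv =
    subst₂ _<_ (sym (deg-zero-clique xu)) (sym (deg-zero-clique xv)) zero-side ,
    subst₂ _<_ (sym (deg-one-clique xv)) (sym (deg-one-clique xu)) one-side
    where
    L≤pu⇒L≤pv : L ≤ position u → L ≤ position v
    L≤pu⇒L≤pv L≤pu = ≤-trans L≤pu (<⇒≤ pu<pv)
    k∸pv<k∸pu : k ∸ suc (position v) < k ∸ suc (position u)
    k∸pv<k∸pu = ∸-monoʳ-< (s≤s pu<pv) (position<k xv)
    zero-side : suc (position u) + (if high u then outDegree u else 0)
              < suc (position v) + (if high v then outDegree v else 0)
    zero-side with high u in hu | high v in hv
    ... | false | _     = +-mono-<-≤ (s≤s pu<pv) z≤n
    ... | true  | true  = +-mono-<-≤ (s≤s pu<pv) (outDegree-mono-high (true⇒ (L ≤? position u) hu) pu<pv)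
    ... | true  | false = ⊥-elim (not-true⇒ (L ≤? position v) (cong not hv) (L≤pu⇒L≤pv (true⇒ (L ≤? position u) hu)))
    one-side : k ∸ suc (position v) + (if not (high v) then outDegree v else 0)
             < k ∸ suc (position u) + (if not (high u) then outDegree u else 0)
    one-side with high u in hu | high v in hv
    ... | _     | true  = +-mono-<-≤ k∸pv<k∸pu z≤n
    ... | false | false = +-mono-<-≤ k∸pv<k∸pu (outDegree-anti-low (≰⇒> (not-true⇒ (L ≤? position v) (cong not hv))) pu<pv)
    ... | true  | false = ⊥-elim (not-true⇒ (L ≤? position v) (cong not hv) (L≤pu⇒L≤pv (true⇒ (L ≤? position u) hu)))

  clique-separated : ∀ {u v} → X u ≡ true → X v ≡ true → u ≢ v →
    ∀ c → totalDeg colouring c u ≢ totalDeg colouring c v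
  clique-separated {u} {v} xu xv u≢v c with <-cmp (position u) (position v) | c
  ... | tri< pu<pv _ _ | zero     = <⇒≢ (proj₁ (clique-edge xu xv pu<pv))
  ... | tri< pu<pv _ _ | suc zero = >⇒≢ (proj₂ (clique-edge xu xv pu<pv))
  ... | tri> _ _ pv<pu | zero     = >⇒≢ (proj₁ (clique-edge xv xu pv<pu))
  ... | tri> _ _ pv<pu | suc zero = <⇒≢ (proj₂ (clique-edge xv xu pv<pu))
  ... | tri≈ _ pu≡pv _ | _        = ⊥-elim (u≢v (position-injective xu xv pu≡pv))

  outDegree-pos : ∀ {x y} → X y ≡ false → adj G x y ≡ true → 0 < outDegree x
  outDegree-pos {x} {y} xy xy-adj = count-pos y (cong₂ _∧_ xy-adj (cong not xy))

  mixed-edge-high : ∀ {x y} → X x ≡ true → X y ≡ false → adj G x y ≡ true → L ≤ position x →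
    totalDeg colouring zero y < totalDeg colouring zero x
  mixed-edge-high {x} {y} xx xy xy-adj L≤px = begin-strict
    totalDeg colouring zero y                              ≤⟨ deg-zero-independent xy ⟩
    k ∸ L + (if k-even then 1 else 0)                      ≤⟨ proj₁ (parity-bounds (⌊n/2⌋-parity k)) ⟩
    suc L                                                  ≤⟨ s≤s L≤px ⟩
    suc (position x)                                       <⟨ m<m+n (suc (position x)) (outDegree-pos xy xy-adj) ⟩
    suc (position x) + outDegree x                         ≡⟨ cong (λ h → suc (position x) + (if h then outDegree x else 0))
                                                                 (sym (dec-true (L ≤? position x) L≤px)) ⟩
    suc (position x) + (if high x then outDegree x else 0) ≡⟨ sym (deg-zero-clique xx) ⟩
    totalDeg colouring zero x                              ∎
    where open ≤-Reasoning

  mixed-edge-low : ∀ {x y} → X x ≡ true → X y ≡ false → adj G x y ≡ true → position x < L →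
    totalDeg colouring (suc zero) y < totalDeg colouring (suc zero) x
  mixed-edge-low {x} {y} xx xy xy-adj px<L = begin-strict
    totalDeg colouring (suc zero) y                                  ≤⟨ deg-one-independent xy ⟩
    L + (if not k-even then 1 else 0)                                ≤⟨ proj₂ (parity-bounds (⌊n/2⌋-parity k)) ⟩
    k ∸ L                                                            ≤⟨ ∸-monoʳ-≤ k px<L ⟩
    k ∸ suc (position x)                                             <⟨ m<m+n (k ∸ suc (position x)) (outDegree-pos xy xy-adj) ⟩
    k ∸ suc (position x) + outDegree x                               ≡⟨ cong (λ h → k ∸ suc (position x) + (if not h then outDegree x else 0))
                                                                          (sym (dec-false (L ≤? position x) (<⇒≱ px<L))) ⟩
    k ∸ suc (position x) + (if not (high x) then outDegree x else 0) ≡⟨ sym (deg-one-clique xx) ⟩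
    totalDeg colouring (suc zero) x                                  ∎
    where open ≤-Reasoning

  mixed-edge : ∀ {x y} → X x ≡ true → X y ≡ false → adj G x y ≡ true →
    totalDeg colouring (paint (high x)) y < totalDeg colouring (paint (high x)) x
  mixed-edge {x} {y} xx xy xy-adj with L ≤? position x
  ... | yes L≤px = subst (λ h → totalDeg colouring (paint h) y < totalDeg colouring (paint h) x)
                         (sym (dec-true (L ≤? position x) L≤px)) (mixed-edge-high xx xy xy-adj L≤px)
  ... | no  L≰px = subst (λ h → totalDeg colouring (paint h) y < totalDeg colouring (paint h) x)
                         (sym (dec-false (L ≤? position x) L≰px)) (mixed-edge-low xx xy xy-adj (≰⇒> L≰px))

  shade-mixed : ∀ {x y} → X x ≡ true → X y ≡ false → shade x y ≡ high x × shade y x ≡ high x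
  shade-mixed xx xy rewrite xx | xy = refl , refl

  irregular : IsTLIR colouring
  irregular u v uv = separated (X u) (X v) refl refl
    where
    Separated : Bool → Set
    Separated s = totalDeg colouring (paint s) u ≢ totalDeg colouring (paint s) v
    separated : ∀ a b → X u ≡ a → X v ≡ b → Separated (shade u v)
    separated true  true  xu xv = clique-separated xu xv (adjacent-distinct G uv) (paint (shade u v))
    separated true  false xu xv =
      subst Separated (sym (proj₁ (shade-mixed xu xv))) (>⇒≢ (mixed-edge xu xv uv))
    separated false true  xu xv =
      subst Separated (sym (proj₂ (shade-mixed xv xu))) (<⇒≢ (mixed-edge xv xu (trans (Graph.sym G v u) uv)))
    separated false false xu xv with () ← trans (sym uv) (independent u v xu xv)

theorem3 : ∀ {n : ℕ} (G : Graph n) → IsSplit G → TlirAtMost G 2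
theorem3 G (X , clique , independent) = colouring , irregular
  where open SplitGraphColouring G X clique independent
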